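{- Fix an even positive integer $k$. Then there is no function $f$ such that $\mathsf{tree}\text{ - }\alpha(G^{k})\le f(\mathsf{tree}\text{ - }\alpha(G))$ holds for all graphs $G$.
   Context: $G^k$ is the graph on $V(G)$ in which two distinct vertices are adjacent iff their distance in $G$ is at most $k$. A tree decomposition of $G$ is a pair $(T,\{X_t\}_{t\in V(T)})$ with $T$ a tree and bags $X_t\subseteq V(G)$ such that every vertex lies in some bag, every edge has both endpoints in some bag, and for every vertex the nodes whose bags contain it induce a connected subtree of $T$. Its independence number is the maximum over bags of the independence number of $G[X_t]$; the tree-independence number $\mathsf{tree}\text{ - }\alpha(G)$ is the minimum independence number over all tree decompositions of $G$. -}

module Defs where

open import Data.Nat using (ℕ; zero; suc; _≤_; _<_; _+_)
open import Data.Fin using (Fin)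
open import Data.Fin.Subset using (Subset; _∈_; _⊆_; ∣_∣)
open import Data.List using (List; []; _∷_; length; last; head)
open import Data.List.Relation.Unary.Linked using (Linked)
open import Data.List.Relation.Unary.Unique.Propositional using (Unique)
open import Data.Maybe using (Maybe; just; nothing)
open import Data.Product using (Σ; ∃; _×_; _,_)
open import Data.Unit using (⊤)
open import Data.Empty using (⊥)
open import Relation.Nullary using (¬_)
open import Relation.Binary.PropositionalEquality using (_≡_; _≢_)

record Graph (n : ℕ) : Set₁ where
  field
    Adj   : Fin n → Fin n → Set
    sym   : ∀ {u v} → Adj u v → Adj v u
    irrefl : ∀ {u} → ¬ Adj u u

open Graph public

data WalkIn {n : ℕ} (G : Graph n) (P : Fin n → Set) : Fin n → Fin n → ℕ → Set where
  stop : ∀ {u} → P u → WalkIn G P u u zero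
  step : ∀ {u v w l} → P u → Adj G u v → WalkIn G P v w l → WalkIn G P u w (suc l)

Walk : ∀ {n} → Graph n → Fin n → Fin n → ℕ → Set
Walk G = WalkIn G (λ _ → ⊤)

DistAtMost : ∀ {n} → Graph n → ℕ → Fin n → Fin n → Set
DistAtMost G k u v = Σ ℕ (λ l → l ≤ k × Walk G u v l)

power : ∀ {n} → Graph n → ℕ → Graph n
power {n} G k = record
  { Adj = λ u v → u ≢ v × DistAtMost G k u v
  ; sym = λ { (u≢v , l , l≤k , w) → (λ e → u≢v (Relation.Binary.PropositionalEquality.sym e)) , l , l≤k , rev w }
  ; irrefl = λ { (u≢u , _) → u≢u Relation.Binary.PropositionalEquality.refl }
  }
  where
  open import Data.Nat.Properties using (+-suc; +-identityʳ)
  snoc : ∀ {u v w l} → WalkIn G (λ _ → ⊤) u v l → Adj G v w → WalkIn G (λ _ → ⊤) u w (suc l)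
  snoc (stop p) a = step p a (stop _)
  snoc (step p a w) b = step p a (snoc w b)
  rev : ∀ {u v l} → WalkIn G (λ _ → ⊤) u v l → WalkIn G (λ _ → ⊤) v u l
  rev (stop p) = stop p
  rev (step p a w) = snoc (rev w) (Graph.sym G a)

Connected : ∀ {m} → Graph m → Set
Connected T = ∀ u v → ∃ λ l → Walk T u v l

record Cycle {m : ℕ} (T : Graph m) : Set where
  field
    verts   : List (Fin m)
    long    : 3 ≤ length verts
    distinct : Unique verts
    linked  : Linked (Adj T) verts
    closing : ∀ {a b} → head verts ≡ just a → last verts ≡ just b → Adj T b a

Acyclic : ∀ {m} → Graph m → Set
Acyclic T = ¬ Cycle T

IsTree : ∀ {m} → Graph m → Set
IsTree {m} T = (0 < m) × Connected T × Acyclic T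

record TreeDecomposition {n : ℕ} (G : Graph n) : Set₁ where
  field
    m     : ℕ
    T     : Graph m
    tree  : IsTree T
    bag   : Fin m → Subset n
    cover : ∀ v → ∃ λ t → v ∈ bag t
    edges : ∀ u v → Adj G u v → ∃ λ t → u ∈ bag t × v ∈ bag t
    coherent : ∀ v t₁ t₂ → v ∈ bag t₁ → v ∈ bag t₂ →
               ∃ λ l → WalkIn T (λ t → v ∈ bag t) t₁ t₂ l

Independent : ∀ {n} → Graph n → Subset n → Set
Independent G S = ∀ u v → u ∈ S → v ∈ S → ¬ Adj G u v

IndepNumAtMost : ∀ {n} → Graph n → Subset n → ℕ → Set
IndepNumAtMost G X w = ∀ S → S ⊆ X → Independent G S → ∣ S ∣ ≤ w

TDIndepAtMost : ∀ {n} {G : Graph n} → TreeDecomposition G → ℕ → Set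
TDIndepAtMost {G = G} D w = ∀ t → IndepNumAtMost G (TreeDecomposition.bag D t) w

TreeαAtMost : ∀ {n} → Graph n → ℕ → Set₁
TreeαAtMost G w = Σ (TreeDecomposition G) (λ D → TDIndepAtMost D w)

IsTreeα : ∀ {n} → Graph n → ℕ → Set₁
IsTreeα G a = TreeαAtMost G a × (∀ w → TreeαAtMost G w → a ≤ w)

{-# OPTIONS --safe #-}

-- Let N = f 1 + 1 and k = 2M.  Take a clique on an N × N grid of cells and hang a path of M vertices from
-- every row and from every column.  A spider whose hub carries the clique and whose arms follow the paths
-- is a tree decomposition into cliques, so tree-α of this graph is 1.  In its k-th power the far ends of
-- two row paths are at distance 2M + 1 > k, and likewise for columns, while every row end is at distance
-- exactly k from every column end.  By the Helly property of subtrees, any tree decomposition of G^k has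
-- a bag containing all N row ends or all N column ends, an independent set of size N > f 1.

module Submission where

open import Defs
open import Data.Nat using (ℕ; zero; suc; _≤_; _<_; _+_; _*_; _∸_; z≤n; s≤s) renaming (_≟_ to _≟ℕ_)
open import Data.Nat.Divisibility using (_∣_; divides)
open import Data.Nat.Properties using (≤-trans; ≤-refl; ≤-reflexive; ≤-total; ≤∧≢⇒<; n≤1+n; m≤m+n; +-comm; +-suc;
  +-identityʳ; +-mono-≤; +-monoʳ-≤; +-monoˡ-≤; ∸-monoʳ-≤; n∸n≡0; 1+n≢n; 1+n≰n; suc-injective; *-comm)
open import Data.Fin using (Fin; zero; suc; toℕ; fromℕ; inject₁) renaming (_≟_ to _≟ᶠ_)
open import Data.Fin.Properties using (toℕ-injective; toℕ-inject₁; toℕ-fromℕ; +↔⊎; *↔×; 1↔⊤; 0≢1+n; all?; ¬∀⟶∃¬)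
  renaming (suc-injective to fsuc-injective)
open import Data.Fin.Subset using (Subset; ∣_∣; ⁅_⁆; _-_) renaming (_∈_ to _∈ₛ_; _⊆_ to _⊆ₛ_)
open import Data.Fin.Subset.Properties using (x∈p⇒∣p-x∣<∣p∣; x∈p∧x≢y⇒x∈p-y; p⊆q⇒∣p∣≤∣q∣; ∣⊥∣≡0; ∣⁅x⁆∣≡1; x∈⁅x⁆;
  x∈⁅y⁆⇒x≡y; nonempty?; Empty-unique) renaming (_∈?_ to _∈ₛ?_)
open import Data.List using (List; []; _∷_; length; last; head; _++_; [_]; allFin; cartesianProduct)
open import Data.List.Properties using (length-++; ++-assoc; ++-identityʳ)
open import Data.List.Relation.Unary.Linked as Linked using (Linked; []; [-]; _∷_)
open import Data.List.Relation.Unary.All as All using (All; []; _∷_)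
open import Data.List.Relation.Unary.AllPairs as AllPairs using ([]; _∷_)
open import Data.List.Relation.Unary.Any using (here; there)
open import Data.List.Relation.Unary.Unique.Propositional using (Unique)
open import Data.List.Relation.Unary.Unique.Propositional.Properties using (++⁺)
open import Data.List.Membership.Propositional using (_∈_; _∉_)
open import Data.List.Membership.Propositional.Properties using (∈-++⁺ˡ; ∈-++⁺ʳ; ∈-++⁻; ∈-∃++; ∈-allFin;
  ∈-cartesianProduct⁺)
open import Data.Maybe using (just)
open import Data.Maybe.Properties using (just-injective)
open import Data.Product using (Σ; ∃; _×_; _,_; proj₁; proj₂)
open import Data.Product.Function.NonDependent.Propositional using (_×-↔_)
open import Data.Sum using (_⊎_; inj₁; inj₂; [_,_]′)
open import Data.Sum.Function.Propositional using (_⊎-↔_)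
open import Data.Unit using (⊤; tt)
open import Data.Bool using (true; false)
open import Data.Empty using (⊥; ⊥-elim)
open import Data.Vec using (tabulate)
open import Data.Vec.Properties using (lookup∘tabulate; lookup⇒[]=; []=⇒lookup)
open import Function using (id; _∘_)
open import Function.Bundles using (_↔_; Inverse; mk↔ₛ′)
open import Function.Properties.Inverse using (↔-trans)
open import Relation.Nullary using (¬_; Dec; yes; no; does)
open import Relation.Nullary.Decidable using (dec-true; dec-false; _×-dec_; _⊎-dec_; _→-dec_)
open import Relation.Binary.Definitions using (DecidableEquality)
open import Relation.Binary.PropositionalEquality as ≡ using (_≡_; _≢_; refl; cong; subst; subst₂)

ConnectedIn : ∀ {m} → Graph m → (Fin m → Set) → Set
ConnectedIn T P = ∀ u v → P u → P v → ∃ λ l → WalkIn T P u v l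

module Walks {m : ℕ} (T : Graph m) where
  open import Data.List.Membership.DecPropositional (_≟ᶠ_ {m}) using (_∈?_)

  vertices : ∀ {P u v l} → WalkIn T P u v l → List (Fin m)
  vertices (stop {u} _) = u ∷ []
  vertices (step {u} _ _ w) = u ∷ vertices w

  IsPath : ∀ {P u v l} → WalkIn T P u v l → Set
  IsPath w = Unique (vertices w)

  start∈vertices : ∀ {P u v l} (w : WalkIn T P u v l) → u ∈ vertices w
  start∈vertices (stop _) = here refl
  start∈vertices (step _ _ _) = here refl

  end∈vertices : ∀ {P u v l} (w : WalkIn T P u v l) → v ∈ vertices w
  end∈vertices (stop _) = here refl
  end∈vertices (step _ _ w) = there (end∈vertices w)

  vertices-satisfy : ∀ {P u v l} (w : WalkIn T P u v l) → All P (vertices w)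
  vertices-satisfy (stop p) = p ∷ []
  vertices-satisfy (step p _ w) = p ∷ vertices-satisfy w

  length-vertices : ∀ {P u v l} (w : WalkIn T P u v l) → length (vertices w) ≡ suc l
  length-vertices (stop _) = refl
  length-vertices (step _ _ w) = cong suc (length-vertices w)

  weaken : ∀ {P Q : Fin m → Set} {u v l} → (∀ {x} → P x → Q x) → WalkIn T P u v l → WalkIn T Q u v l
  weaken f (stop p) = stop (f p)
  weaken f (step p a w) = step (f p) a (weaken f w)

  vertices-weaken : ∀ {P Q : Fin m → Set} {u v l} (f : ∀ {x} → P x → Q x) (w : WalkIn T P u v l) →
                    vertices (weaken f w) ≡ vertices w
  vertices-weaken f (stop _) = refl
  vertices-weaken f (step _ _ w) = cong (_ ∷_) (vertices-weaken f w)

  restrict : ∀ {P Q : Fin m → Set} {u v l} (w : WalkIn T P u v l) → All Q (vertices w) →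
             WalkIn T (λ x → P x × Q x) u v l
  restrict (stop p) (q ∷ []) = stop (p , q)
  restrict (step p a w) (q ∷ qs) = step (p , q) a (restrict w qs)

  append : ∀ {P u v w l₁ l₂} → WalkIn T P u v l₁ → WalkIn T P v w l₂ → WalkIn T P u w (l₁ + l₂)
  append (stop _) r = r
  append (step p a w) r = step p a (append w r)

  ∈-append⁻ : ∀ {P u v w l₁ l₂} (g : WalkIn T P u v l₁) (r : WalkIn T P v w l₂) →
              ∀ {x} → x ∈ vertices (append g r) → x ∈ vertices g ⊎ x ∈ vertices r
  ∈-append⁻ (stop _) r x∈ = inj₂ x∈
  ∈-append⁻ (step _ _ g) r (here e) = inj₁ (here e)
  ∈-append⁻ (step _ _ g) r (there x∈) with ∈-append⁻ g r x∈
  ... | inj₁ h = inj₁ (there h)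
  ... | inj₂ h = inj₂ h

  ∈-append⁺ʳ : ∀ {P u v w l₁ l₂} (g : WalkIn T P u v l₁) (r : WalkIn T P v w l₂) →
               ∀ {x} → x ∈ vertices r → x ∈ vertices (append g r)
  ∈-append⁺ʳ (stop _) r x∈ = x∈
  ∈-append⁺ʳ (step _ _ g) r x∈ = there (∈-append⁺ʳ g r x∈)

  append-isPath : ∀ {P u v w l₁ l₂} (g : WalkIn T P u v l₁) (r : WalkIn T P v w l₂) →
                  IsPath g → IsPath r → (∀ {x} → x ∈ vertices g → x ∈ vertices r → x ≡ v) →
                  IsPath (append g r)
  append-isPath (stop _) r _ ur _ = ur
  append-isPath (step {u} _ _ g) r (u∉g ∷ ug) ur meet =
    All.tabulate u≢ ∷ append-isPath g r ug ur (λ x∈g x∈r → meet (there x∈g) x∈r)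
    where
    u≢ : ∀ {x} → x ∈ vertices (append g r) → u ≢ x
    u≢ x∈ refl with ∈-append⁻ g r x∈
    ... | inj₁ x∈g = All.lookup u∉g x∈g refl
    ... | inj₂ x∈r with meet (here refl) x∈r
    ... | refl = All.lookup u∉g (end∈vertices g) refl

  snoc : ∀ {P u v w l} → WalkIn T P u v l → Adj T v w → P w → WalkIn T P u w (suc l)
  snoc (stop p) a q = step p a (stop q)
  snoc (step p a w) b q = step p a (snoc w b q)

  reverse : ∀ {P u v l} → WalkIn T P u v l → WalkIn T P v u l
  reverse (stop p) = stop p
  reverse (step p a w) = snoc (reverse w) (sym T a) p

  suffix : ∀ {P u v l x} (w : WalkIn T P u v l) → x ∈ vertices w → IsPath w →
           ∃ λ l′ → Σ (WalkIn T P x v l′) IsPath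
  suffix (stop p) (here refl) uw = 0 , stop p , uw
  suffix (step p a w) (here refl) uw = _ , step p a w , uw
  suffix (step _ _ w) (there x∈) (_ ∷ uw) = suffix w x∈ uw

  prefix : ∀ {P u v l x} (w : WalkIn T P u v l) → x ∈ vertices w →
           ∃ λ l′ → Σ (WalkIn T P u x l′) λ w′ →
             (∀ {y} → y ∈ vertices w′ → y ∈ vertices w) × (IsPath w → IsPath w′)
  prefix (stop p) (here refl) = 0 , stop p , id , id
  prefix (step p _ _) (here refl) = 0 , stop p , (λ { (here e) → here e }) , (λ _ → [] ∷ [])
  prefix (step p a w) (there x∈) with prefix w x∈
  ... | _ , w′ , sub , path = _ , step p a w′ ,
        (λ { (here e) → here e ; (there y∈) → there (sub y∈) }) ,
        (λ { (u∉ ∷ uw) → All.tabulate (λ y∈ → All.lookup u∉ (sub y∈)) ∷ path uw })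

  shortcut : ∀ {P u v l} → WalkIn T P u v l → ∃ λ l′ → Σ (WalkIn T P u v l′) IsPath
  shortcut (stop p) = 0 , stop p , [] ∷ []
  shortcut (step {u} p a w) with shortcut w
  ... | l′ , w′ , uw′ with u ∈? vertices w′
  ... | yes u∈ = suffix w′ u∈ uw′
  ... | no u∉ = suc l′ , step p a w′ , All.tabulate (λ x∈ e → u∉ (subst (_∈ vertices w′) (≡.sym e) x∈)) ∷ uw′

length-++-≥ : ∀ {A : Set} {a b} (xs ys : List A) → a ≤ length xs → b ≤ length ys → a + b ≤ length (xs ++ ys)
length-++-≥ xs ys a≤ b≤ = subst (_ ≤_) (≡.sym (length-++ xs)) (+-mono-≤ a≤ b≤)

module Cycles {m : ℕ} (T : Graph m) where
  open import Data.List.Membership.DecPropositional (_≟ᶠ_ {m}) using (_∈?_)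
  open Walks T

  private
    linked-++ : ∀ {Q w r l} (q : WalkIn T Q w r l) {h} (s : List (Fin m)) →
                Adj T r h → Linked (Adj T) (h ∷ s) → Linked (Adj T) (vertices q ++ h ∷ s)
    linked-++ (stop _) s a L = a ∷ L
    linked-++ (step _ a q@(stop _)) s b L = a ∷ linked-++ q s b L
    linked-++ (step _ a q@(step _ _ _)) s b L = a ∷ linked-++ q s b L

    head-++ : ∀ {Q w r l} (q : WalkIn T Q w r l) (s : List (Fin m)) → head (vertices q ++ s) ≡ just w
    head-++ (stop _) s = refl
    head-++ (step _ _ _) s = refl

    last-++ : (xs : List (Fin m)) (h : Fin m) (s : List (Fin m)) → last (xs ++ h ∷ s) ≡ last (h ∷ s)
    last-++ [] h s = refl
    last-++ (x ∷ []) h s = refl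
    last-++ (x ∷ y ∷ xs) h s = last-++ (y ∷ xs) h s

    last-∈ : ∀ (x : Fin m) xs {y} → last (x ∷ xs) ≡ just y → y ∈ x ∷ xs
    last-∈ x [] refl = here refl
    last-∈ x (z ∷ xs) e = there (last-∈ z xs e)

    last-snoc : ∀ (zs : List (Fin m)) y → last (zs ++ [ y ]) ≡ just y
    last-snoc [] y = refl
    last-snoc (z ∷ []) y = refl
    last-snoc (z ∷ z′ ∷ zs) y = last-snoc (z′ ∷ zs) y

    linked-snoc : ∀ (zs : List (Fin m)) {y} → Linked (Adj T) zs → (∀ {z} → last zs ≡ just z → Adj T z y) →
                  Linked (Adj T) (zs ++ [ y ])
    linked-snoc [] L a = [-]
    linked-snoc (z ∷ []) L a = a refl ∷ [-]
    linked-snoc (z ∷ z′ ∷ zs) (a ∷ L) b = a ∷ linked-snoc (z′ ∷ zs) L b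

  path+arc⇒cycle : ∀ {Q w r l} (q : WalkIn T Q w r l) → IsPath q →
                   ∀ {u} h s → Linked (Adj T) (h ∷ s) → Unique (h ∷ s) → last (h ∷ s) ≡ just u →
                   (∀ {x} → x ∈ vertices q → x ∉ h ∷ s) → Adj T r h → Adj T u w →
                   (1 ≤ length s ⊎ r ≢ w) → Cycle T
  path+arc⇒cycle {Q} {w = w} q uq {u} h s L U last≡u disjoint rh uw long = record
    { verts = vertices q ++ h ∷ s
    ; long = long-enough q s long
    ; distinct = ++⁺ uq U (λ (x∈q , x∈s) → disjoint x∈q x∈s)
    ; linked = linked-++ q s rh L
    ; closing = λ hd lt → subst₂ (Adj T)
        (just-injective (≡.trans (≡.sym last≡u) (≡.trans (≡.sym (last-++ (vertices q) h s)) lt)))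
        (just-injective (≡.trans (≡.sym (head-++ q (h ∷ s))) hd)) uw
    }
    where
    long-enough : ∀ {r l} (q : WalkIn T Q w r l) s → (1 ≤ length s ⊎ r ≢ w) → 3 ≤ length (vertices q ++ h ∷ s)
    long-enough q (x ∷ s) _ =
      length-++-≥ (vertices q) (h ∷ x ∷ s) (subst (1 ≤_) (≡.sym (length-vertices q)) (s≤s z≤n)) (s≤s (s≤s z≤n))
    long-enough (stop _) [] (inj₂ r≢w) = ⊥-elim (r≢w refl)
    long-enough q@(step _ _ q′) [] _ =
      length-++-≥ (vertices q) (h ∷ []) (subst (2 ≤_) (≡.sym (cong suc (length-vertices q′))) (s≤s (s≤s z≤n))) (s≤s z≤n)

  -- Walk along p, collecting the vertices passed in the arc h ∷ s (which leads back to u), until p first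
  -- meets q; the part of q up to that vertex together with the arc is a cycle.
  fork⇒cycle : ∀ {Q R w v l₁ l₂ u} h s → Linked (Adj T) (h ∷ s) → Unique (h ∷ s) → last (h ∷ s) ≡ just u →
               Adj T u w → (q : WalkIn T Q w v l₁) → IsPath q → (∀ {x} → x ∈ h ∷ s → x ∉ vertices q) →
               ∀ {r} (p : WalkIn T R r v l₂) → IsPath p → (∀ {x} → x ∈ vertices p → x ∉ h ∷ s) →
               Adj T h r → (1 ≤ length s ⊎ r ≢ w) → Cycle T
  fork⇒cycle h s L U last≡u uw q uq q∉ {r} p up p∉ hr long with r ∈? vertices q
  ... | yes r∈q = let (_ , q₁ , q₁⊆q , q₁-path) = prefix q r∈q in
    path+arc⇒cycle q₁ (q₁-path uq) h s L U last≡u (λ x∈q₁ x∈ → q∉ x∈ (q₁⊆q x∈q₁)) (sym T hr) uw long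
  fork⇒cycle h s L U last≡u uw q uq q∉ (stop _) up p∉ hr long | no r∉q = ⊥-elim (r∉q (end∈vertices q))
  fork⇒cycle h s L U last≡u uw q uq q∉ (step {r} _ a p) (r∉p ∷ up) p∉ hr _ | no r∉q =
    fork⇒cycle r (h ∷ s) (sym T hr ∷ L)
      (All.tabulate (λ x∈ e → p∉ (here refl) (subst (_∈ h ∷ s) (≡.sym e) x∈)) ∷ U)
      last≡u uw q uq (λ { (here refl) → r∉q ; (there x∈) → q∉ x∈ }) p up
      (λ { x∈ (here refl) → All.lookup r∉p x∈ refl ; x∈ (there y∈) → p∉ (there x∈) y∈ })
      a (inj₁ (s≤s z≤n))

  acyclic⇒unique-paths : Acyclic T → ∀ {P Q u v l₁ l₂} (p : WalkIn T P u v l₁) (q : WalkIn T Q u v l₂) →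
                         IsPath p → IsPath q → vertices p ≡ vertices q
  acyclic⇒unique-paths acyclic (stop _) (stop _) _ _ = refl
  acyclic⇒unique-paths acyclic (stop _) (step _ _ q) _ (u∉ ∷ _) = ⊥-elim (All.lookup u∉ (end∈vertices q) refl)
  acyclic⇒unique-paths acyclic (step _ _ p) (stop _) (u∉ ∷ _) _ = ⊥-elim (All.lookup u∉ (end∈vertices p) refl)
  acyclic⇒unique-paths acyclic (step {u} {v₁} _ a p) (step {v = w₁} _ b q) (u∉p ∷ up) (u∉q ∷ uq) with v₁ ≟ᶠ w₁
  ... | yes refl = cong (u ∷_) (acyclic⇒unique-paths acyclic p q up uq)
  ... | no v₁≢w₁ = ⊥-elim (acyclic (fork⇒cycle u [] [-] ([] ∷ []) refl b q uq
                      (λ { (here refl) x∈ → All.lookup u∉q x∈ refl }) p up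
                      (λ { x∈ (here refl) → All.lookup u∉p x∈ refl }) a (inj₂ v₁≢w₁)))


  rotate₁ : ∀ x zs → (c : Cycle T) → Cycle.verts c ≡ x ∷ zs →
            Σ (Cycle T) λ c′ → Cycle.verts c′ ≡ zs ++ [ x ]
  rotate₁ x [] c e with subst (λ vs → 3 ≤ length vs) e (Cycle.long c)
  ... | s≤s ()
  rotate₁ x (z ∷ zs) c refl = record
    { verts = (z ∷ zs) ++ [ x ]
    ; long = subst (3 ≤_) (≡.trans (+-comm 1 (length (z ∷ zs))) (≡.sym (length-++ (z ∷ zs)))) long
    ; distinct = ++⁺ (AllPairs.tail distinct) ([] ∷ [])
                   (λ { (x∈ , here refl) → All.lookup (AllPairs.head distinct) x∈ refl })
    ; linked = linked-snoc (z ∷ zs) (Linked.tail linked) (closing refl)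
    ; closing = λ hd lt → subst₂ (Adj T) (just-injective (≡.trans (≡.sym (last-snoc (z ∷ zs) x)) lt))
                                         (just-injective hd) (Linked.head linked)
    } , refl
    where open Cycle c

  rotate : ∀ pre y ys → (c : Cycle T) → Cycle.verts c ≡ pre ++ y ∷ ys →
           Σ (Cycle T) λ c′ → Cycle.verts c′ ≡ (y ∷ ys) ++ pre
  rotate [] y ys c e = c , ≡.trans e (≡.sym (++-identityʳ (y ∷ ys)))
  rotate (x ∷ pre) y ys c e with rotate₁ x (pre ++ y ∷ ys) c e
  ... | c₁ , e₁ with rotate pre y (ys ++ [ x ]) c₁ (≡.trans e₁ (++-assoc pre (y ∷ ys) [ x ]))
  ... | c₂ , e₂ = c₂ , ≡.trans e₂ (++-assoc (y ∷ ys) [ x ] pre)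

  module _ (rank : Fin m → ℕ) (rank-≢ : ∀ {u v} → Adj T u v → rank u ≢ rank v)
           (one-lower : ∀ {u v w} → Adj T u v → Adj T u w → rank v < rank u → rank w < rank u → v ≡ w) where

    private
      argmax : ∀ x xs → ∃ λ y → y ∈ x ∷ xs × (∀ {z} → z ∈ x ∷ xs → rank z ≤ rank y)
      argmax x [] = x , here refl , λ { (here refl) → ≤-refl }
      argmax x (x′ ∷ xs) with argmax x′ xs
      ... | y , y∈ , max with ≤-total (rank x) (rank y)
      ... | inj₁ x≤y = y , there y∈ , λ { (here refl) → x≤y ; (there z∈) → max z∈ }
      ... | inj₂ y≤x = x , here refl , λ { (here refl) → ≤-refl ; (there z∈) → ≤-trans (max z∈) y≤x }

      last-just : ∀ (x : Fin m) xs → ∃ λ y → last (x ∷ xs) ≡ just y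
      last-just x [] = x , refl
      last-just x (z ∷ xs) = last-just z xs

      -- Both cycle-neighbours of a vertex of maximal rank are below it, so they coincide.
      no-max-first : (c : Cycle T) → ∀ x xs → Cycle.verts c ≡ x ∷ xs →
                     (∀ {v} → v ∈ Cycle.verts c → rank v ≤ rank x) → ⊥
      no-max-first c x [] e _ with subst (λ vs → 3 ≤ length vs) e (Cycle.long c)
      ... | s≤s ()
      no-max-first c x (_ ∷ []) e _ with subst (λ vs → 3 ≤ length vs) e (Cycle.long c)
      ... | s≤s (s≤s ())
      no-max-first c x (b ∷ z ∷ zs) e max with last-just z zs
      ... | y , last≡y = All.lookup b∉ (last-∈ z zs last≡y) (one-lower x→b x→y (below x→b b∈) (below x→y y∈))
        where
        b∉ = AllPairs.head (AllPairs.tail (subst Unique e (Cycle.distinct c)))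
        x→b = Linked.head (subst (Linked (Adj T)) e (Cycle.linked c))
        x→y = sym T (Cycle.closing c (cong head e) (≡.trans (cong last e) last≡y))
        b∈ = subst (b ∈_) (≡.sym e) (there (here refl))
        y∈ = subst (y ∈_) (≡.sym e) (there (there (last-∈ z zs last≡y)))
        below : ∀ {v} → Adj T x v → v ∈ Cycle.verts c → rank v < rank x
        below x→v v∈ = ≤∧≢⇒< (max v∈) (λ e → rank-≢ x→v (≡.sym e))

    one-lower-neighbour⇒acyclic : Acyclic T
    one-lower-neighbour⇒acyclic c with Cycle.verts c in verts≡
    ... | [] with subst (λ vs → 3 ≤ length vs) verts≡ (Cycle.long c)
    ...   | ()
    one-lower-neighbour⇒acyclic c | v ∷ vs with argmax v vs
    ... | y , y∈ , max with ∈-∃++ y∈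
    ... | pre , post , split with rotate pre y post c (≡.trans verts≡ split)
    ... | c′ , verts′≡ = no-max-first c′ y (post ++ pre) verts′≡ (λ v∈ → max (in-c (subst (_ ∈_) verts′≡ v∈)))
      where
      in-c : ∀ {u} → u ∈ (y ∷ post) ++ pre → u ∈ v ∷ vs
      in-c u∈ with ∈-++⁻ (y ∷ post) u∈
      ... | inj₁ u∈post = subst (_ ∈_) (≡.sym split) (∈-++⁺ʳ pre u∈post)
      ... | inj₂ u∈pre = subst (_ ∈_) (≡.sym split) (∈-++⁺ˡ u∈pre)

module Helly {m : ℕ} {T : Graph m} (acyclic : Acyclic T) where
  open Walks T
  open Cycles T

  ConnectedIn-∩ : ∀ {P Q} → ConnectedIn T P → ConnectedIn T Q → ConnectedIn T (λ x → P x × Q x)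
  ConnectedIn-∩ {P} {Q} cP cQ u v (Pu , Qu) (Pv , Qv)
    with shortcut (proj₂ (cP u v Pu Pv)) | shortcut (proj₂ (cQ u v Qu Qv))
  ... | _ , p , up | _ , q , uq =
    _ , restrict p (subst (All Q) (≡.sym (acyclic⇒unique-paths acyclic p q up uq)) (vertices-satisfy q))

  -- Walking an X-path from y towards z, the first vertex c in Y lies on the Y-path from x to c glued to
  -- the walked part; that glued path is the unique path from x to y, which stays in Z.
  module _ {X Y Z : Fin m → Set} (cY : ConnectedIn T Y) (cZ : ConnectedIn T Z) (Y? : ∀ t → Dec (Y t))
           {x} (Yx : Y x) (Zx : Z x) {y} (Zy : Z y) where

    first-in-Y : ∀ {c z l l′} (walked : WalkIn T (λ _ → ⊤) c y l′) → IsPath walked →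
                 (∀ {t} → t ∈ vertices walked → t ≢ c → ¬ Y t) →
                 (p : WalkIn T X c z l) → IsPath p → (∀ {t} → t ∈ vertices p → t ∈ vertices walked → t ≡ c) →
                 Y z → ∃ λ t → X t × Y t × Z t
    first-in-Y {c} walked uw ¬Y p up disjoint Yz with Y? c
    first-in-Y {c} walked uw ¬Y p up disjoint Yz | yes Yc
      with shortcut (proj₂ (cY x c Yx Yc)) | shortcut (proj₂ (cZ x y Zx Zy))
    ... | _ , γ , uγ | _ , δ , uδ =
      c , All.lookup (vertices-satisfy p) (start∈vertices p) , Yc ,
      All.lookup (vertices-satisfy δ)
        (subst (c ∈_) (acyclic⇒unique-paths acyclic (append γ′ walked) δ glued-path uδ)
               (∈-append⁺ʳ γ′ walked (start∈vertices walked)))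
      where
      γ′ = weaken (λ _ → tt) γ
      vγ′ = vertices-weaken (λ _ → tt) γ
      on-γ-and-walked⇒c : ∀ {t} → t ∈ vertices γ′ → t ∈ vertices walked → t ≡ c
      on-γ-and-walked⇒c {t} t∈γ t∈w with t ≟ᶠ c
      ... | yes t≡c = t≡c
      ... | no t≢c = ⊥-elim (¬Y t∈w t≢c (All.lookup (vertices-satisfy γ) (subst (t ∈_) vγ′ t∈γ)))
      glued-path : IsPath (append γ′ walked)
      glued-path = append-isPath γ′ walked (subst Unique (≡.sym vγ′) uγ) uw on-γ-and-walked⇒c
    first-in-Y walked uw ¬Y (stop _) up disjoint Yz | no ¬Yc = ⊥-elim (¬Yc Yz)
    first-in-Y {c} walked uw ¬Y (step {v = c′} _ a p) (c∉p ∷ up) disjoint Yz | no ¬Yc =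
      first-in-Y (step tt (sym T a) walked) walked′-path ¬Y′ p up disjoint′ Yz
      where
      c′≢c : c′ ≢ c
      c′≢c e = All.lookup c∉p (subst (_∈ vertices p) e (start∈vertices p)) refl
      walked′-path : Unique (c′ ∷ vertices walked)
      walked′-path =
        All.tabulate (λ t∈ e → c′≢c (disjoint (there (start∈vertices p)) (subst (_∈ vertices walked) (≡.sym e) t∈))) ∷ uw
      ¬Y′ : ∀ {t} → t ∈ c′ ∷ vertices walked → t ≢ c′ → ¬ Y t
      ¬Y′ (here refl) t≢c′ = ⊥-elim (t≢c′ refl)
      ¬Y′ {t} (there t∈) _ with t ≟ᶠ c
      ... | yes refl = ¬Yc
      ... | no t≢c = ¬Y t∈ t≢c
      disjoint′ : ∀ {t} → t ∈ vertices p → t ∈ c′ ∷ vertices walked → t ≡ c′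
      disjoint′ t∈ (here refl) = refl
      disjoint′ t∈ (there t∈w) = ⊥-elim (All.lookup c∉p (subst (_∈ vertices p) (disjoint (there t∈) t∈w) t∈) refl)

  helly₃ : ∀ {X Y Z : Fin m → Set} → ConnectedIn T X → ConnectedIn T Y → ConnectedIn T Z → (∀ t → Dec (Y t)) →
           ∀ {x y z} → Y x → Z x → X y → Z y → X z → Y z → ∃ λ t → X t × Y t × Z t
  helly₃ cX cY cZ Y? {x} {y} {z} Yx Zx Xy Zy Xz Yz with shortcut (proj₂ (cX y z Xy Xz))
  ... | _ , p , up = first-in-Y cY cZ Y? Yx Zx Zy (stop tt) ([] ∷ [])
                       (λ { (here refl) t≢y → ⊥-elim (t≢y refl) }) p up (λ { _ (here refl) → refl }) Yz

  helly-within : ∀ {I : Set} (F : I → Fin m → Set) → (∀ i t → Dec (F i t)) → (∀ i → ConnectedIn T (F i)) →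
                 (∀ i j → ∃ λ t → F i t × F j t) →
                 (X : Fin m → Set) → ConnectedIn T X → (∀ i → ∃ λ t → X t × F i t) → ∃ X →
                 (is : List I) → ∃ λ t → X t × All (λ i → F i t) is
  helly-within F F? cF meet X cX X-meets (t , Xt) [] = t , Xt , []
  helly-within F F? cF meet X cX X-meets _ (i ∷ is)
    with helly-within F F? cF meet (λ t → X t × F i t) (ConnectedIn-∩ cX (cF i)) X∩Fᵢ-meets (X-meets i) is
    where
    X∩Fᵢ-meets : ∀ j → ∃ λ t → (X t × F i t) × F j t
    X∩Fᵢ-meets j with X-meets j | X-meets i | meet i j
    ... | y , Xy , Fⱼy | z , Xz , Fᵢz | x , Fᵢx , Fⱼx with helly₃ cX (cF i) (cF j) (F? i) Fᵢx Fⱼx Xy Fⱼy Xz Fᵢz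
    ... | t , Xt , Fᵢt , Fⱼt = t , (Xt , Fᵢt) , Fⱼt
  ... | t , (Xt , Fᵢt) , Fs = t , Xt , Fᵢt ∷ Fs

module _ {n : ℕ} {H : Graph n} (D : TreeDecomposition H) where
  open TreeDecomposition D
  open Walks T

  module _ (A B : Subset n) (complete : ∀ a b → a ∈ₛ A → b ∈ₛ B → Adj H a b) where
    private
      root : Fin m
      root with m | proj₁ tree
      ... | suc _ | _ = zero

      nodes-connected : ConnectedIn T (λ _ → ⊤)
      nodes-connected u v _ _ = let (l , w) = proj₁ (proj₂ tree) u v in l , weaken (λ _ → tt) w

      Covers : Fin n × Fin n → Fin m → Set
      Covers (a , b) t = a ∈ₛ A → b ∈ₛ B → a ∈ₛ bag t ⊎ b ∈ₛ bag t

      Covers? : ∀ i t → Dec (Covers i t)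
      Covers? (a , b) t = (a ∈ₛ? A) →-dec ((b ∈ₛ? B) →-dec ((a ∈ₛ? bag t) ⊎-dec (b ∈ₛ? bag t)))

      Covers-connected : ∀ i → ConnectedIn T (Covers i)
      Covers-connected (a , b) u v Cu Cv with a ∈ₛ? A | b ∈ₛ? B
      ... | no a∉A | _ = let (l , w) = nodes-connected u v tt tt in l , weaken (λ _ a∈A → ⊥-elim (a∉A a∈A)) w
      ... | yes _ | no b∉B = let (l , w) = nodes-connected u v tt tt in l , weaken (λ _ _ b∈B → ⊥-elim (b∉B b∈B)) w
      ... | yes a∈A | yes b∈B = join (Cu a∈A b∈B) (Cv a∈A b∈B)
        where
        edge-node = edges a b (complete a b a∈A b∈B)
        e = proj₁ edge-node
        via-a : ∀ {x} → a ∈ₛ bag x → Covers (a , b) x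
        via-a h _ _ = inj₁ h
        via-b : ∀ {x} → b ∈ₛ bag x → Covers (a , b) x
        via-b h _ _ = inj₂ h
        join : a ∈ₛ bag u ⊎ b ∈ₛ bag u → a ∈ₛ bag v ⊎ b ∈ₛ bag v → ∃ λ l → WalkIn T (Covers (a , b)) u v l
        join (inj₁ au) (inj₁ av) = let (l , w) = coherent a u v au av in l , weaken via-a w
        join (inj₂ bu) (inj₂ bv) = let (l , w) = coherent b u v bu bv in l , weaken via-b w
        join (inj₁ au) (inj₂ bv) =
          let (_ , w₁) = coherent a u e au (proj₁ (proj₂ edge-node))
              (_ , w₂) = coherent b e v (proj₂ (proj₂ edge-node)) bv
          in _ , append (weaken via-a w₁) (weaken via-b w₂)
        join (inj₂ bu) (inj₁ av) =
          let (_ , w₁) = coherent b u e bu (proj₂ (proj₂ edge-node))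
              (_ , w₂) = coherent a e v (proj₁ (proj₂ edge-node)) av
          in _ , append (weaken via-b w₁) (weaken via-a w₂)

      Covers-nonempty : ∀ i → ∃ λ t → Covers i t
      Covers-nonempty (a , b) with a ∈ₛ? A | b ∈ₛ? B
      ... | no a∉A | _ = root , λ a∈A → ⊥-elim (a∉A a∈A)
      ... | yes _ | no b∉B = root , λ _ b∈B → ⊥-elim (b∉B b∈B)
      ... | yes a∈A | yes b∈B = let (t , at , _) = edges a b (complete a b a∈A b∈B) in t , λ _ _ → inj₁ at

      Covers-meet : ∀ i j → ∃ λ t → Covers i t × Covers j t
      Covers-meet (a , b) (a′ , b′) with a ∈ₛ? A | b′ ∈ₛ? B
      ... | yes a∈A | yes b′∈B = let (t , at , b′t) = edges a b′ (complete a b′ a∈A b′∈B) in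
                                 t , (λ _ _ → inj₁ at) , (λ _ _ → inj₂ b′t)
      ... | no a∉A | _ = let (t , c) = Covers-nonempty (a′ , b′) in t , (λ a∈A → ⊥-elim (a∉A a∈A)) , c
      ... | yes _ | no b′∉B = let (t , c) = Covers-nonempty (a , b) in t , c , (λ _ b′∈B → ⊥-elim (b′∉B b′∈B))

    -- The node sets  T_a ∪ T_b  (a ∈ A, b ∈ B) are subtrees, since T_a and T_b share the node of the edge ab,
    -- and pairwise intersect, since T_a meets T_b′.  By Helly one node t lies in all of them; if bag t
    -- misses some a ∈ A it must contain all of B.
    complete-pair-in-bag : ∃ λ t → A ⊆ₛ bag t ⊎ B ⊆ₛ bag t
    complete-pair-in-bag
      with Helly.helly-within (proj₂ (proj₂ tree)) Covers Covers? Covers-connected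
             Covers-meet (λ _ → ⊤) nodes-connected (λ i → let (t , c) = Covers-nonempty i in t , tt , c)
             (root , tt) (cartesianProduct (allFin n) (allFin n))
    ... | t , _ , covers with all? (λ a → (a ∈ₛ? A) →-dec (a ∈ₛ? bag t))
    ... | yes A⊆ = t , inj₁ (A⊆ _)
    ... | no A⊈ with ¬∀⟶∃¬ n _ (λ a → (a ∈ₛ? A) →-dec (a ∈ₛ? bag t)) A⊈
    ... | a , a-missing with a ∈ₛ? A
    ... | no a∉A = ⊥-elim (a-missing (λ a∈A → ⊥-elim (a∉A a∈A)))
    ... | yes a∈A = t , inj₂ λ {b} b∈B →
            [ (λ a∈t → ⊥-elim (a-missing (λ _ → a∈t))) , id ]′
              (All.lookup covers (∈-cartesianProduct⁺ (∈-allFin a) (∈-allFin b)) a∈A b∈B)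

module _ {n : ℕ} {P : Fin n → Set} (P? : ∀ x → Dec (P x)) where

  subset : Subset n
  subset = tabulate (does ∘ P?)

  ∈-subset⁺ : ∀ {x} → P x → x ∈ₛ subset
  ∈-subset⁺ {x} Px = lookup⇒[]= x subset (≡.trans (lookup∘tabulate _ x) (dec-true (P? x) Px))

  ∈-subset⁻ : ∀ {x} → x ∈ₛ subset → P x
  ∈-subset⁻ {x} x∈ with P? x
  ... | yes Px = Px
  ... | no ¬Px =
    ⊥-elim (true≢false (≡.trans (≡.sym ([]=⇒lookup x∈)) (≡.trans (lookup∘tabulate _ x) (dec-false (P? x) ¬Px))))
    where
    true≢false : ¬ (true ≡ false)
    true≢false ()

injective⇒≤∣p∣ : ∀ {n} N (g : Fin N → Fin n) → (∀ {i j} → g i ≡ g j → i ≡ j) → (p : Subset n) →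
                 (∀ i → g i ∈ₛ p) → N ≤ ∣ p ∣
injective⇒≤∣p∣ zero g _ p _ = z≤n
injective⇒≤∣p∣ (suc N) g inj p g∈ =
  ≤-trans (s≤s (injective⇒≤∣p∣ N (g ∘ suc) (fsuc-injective ∘ inj) (p - g zero)
                 (λ i → x∈p∧x≢y⇒x∈p-y (g∈ (suc i)) (λ e → 0≢1+n (inj (≡.sym e))))))
          (x∈p⇒∣p-x∣<∣p∣ (g∈ zero))

all-equal⇒∣p∣≤1 : ∀ {n} (p : Subset n) → (∀ {x y} → x ∈ₛ p → y ∈ₛ p → x ≡ y) → ∣ p ∣ ≤ 1
all-equal⇒∣p∣≤1 {n} p all-equal with nonempty? p
... | no empty = subst (_≤ 1) (≡.sym (≡.trans (cong ∣_∣ (Empty-unique empty)) (∣⊥∣≡0 n))) z≤n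
... | yes (x , x∈p) = subst (∣ p ∣ ≤_) (∣⁅x⁆∣≡1 x)
        (p⊆q⇒∣p∣≤∣q∣ (λ y∈p → subst (_∈ₛ ⁅ x ⁆) (all-equal x∈p y∈p) (x∈⁅x⁆ x)))

TreeαAtMost⇒≥1 : ∀ {n} (G : Graph n) → Fin n → ∀ {w} → TreeαAtMost G w → 1 ≤ w
TreeαAtMost⇒≥1 G v (D , bounded) with TreeDecomposition.cover D v
... | t , v∈t = subst (_≤ _) (∣⁅x⁆∣≡1 v)
      (bounded t ⁅ v ⁆ (λ x∈ → subst (_∈ₛ _) (≡.sym (x∈⁅y⁆⇒x≡y v x∈)) v∈t)
        (λ x y x∈ y∈ → irrefl G ∘ subst₂ (Adj G) (x∈⁅y⁆⇒x≡y v x∈) (x∈⁅y⁆⇒x≡y v y∈)))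

potential-bound : ∀ {n} (G : Graph n) (φ : Fin n → ℕ) → (∀ {x y} → Adj G x y → φ y ≤ suc (φ x)) →
                  ∀ {P x y l} → WalkIn G P x y l → φ y ≤ φ x + l
potential-bound G φ bound (stop {x} _) = ≤-reflexive (≡.sym (+-identityʳ (φ x)))
potential-bound G φ bound (step {x} {l = l} _ a w) =
  ≤-trans (potential-bound G φ bound w) (≤-trans (+-monoˡ-≤ l (bound a)) (≤-reflexive (≡.sym (+-suc (φ x) l))))

module OnFiniteType {A : Set} {n : ℕ} (code : Fin n ↔ A) where
  open Inverse code public using () renaming (to to decode; from to encode;
    strictlyInverseˡ to decode-encode; strictlyInverseʳ to encode-decode)

  encode-injective : ∀ {a b} → encode a ≡ encode b → a ≡ b
  encode-injective {a} {b} e = ≡.trans (≡.sym (decode-encode a)) (≡.trans (cong decode e) (decode-encode b))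

  decode-injective : ∀ {x y} → decode x ≡ decode y → x ≡ y
  decode-injective {x} {y} e = ≡.trans (≡.sym (encode-decode x)) (≡.trans (cong encode e) (encode-decode y))

  module _ (R : A → A → Set) (R-sym : ∀ {a b} → R a b → R b a) (R-irrefl : ∀ {a} → ¬ R a a) where

    graph : Graph n
    graph = record { Adj = λ x y → R (decode x) (decode y) ; sym = R-sym ; irrefl = R-irrefl }

    edge : ∀ a b → R a b → Adj graph (encode a) (encode b)
    edge a b = subst₂ R (≡.sym (decode-encode a)) (≡.sym (decode-encode b))

walk-along : ∀ {n m} (H : Graph n) (pos : Fin (suc m) → Fin n) → (∀ e → Adj H (pos (inject₁ e)) (pos (suc e))) →
             ∀ e → WalkIn H (λ _ → ⊤) (pos zero) (pos e) (toℕ e)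
walk-along H pos adj zero = stop tt
walk-along {m = suc m} H pos adj (suc e) = step tt (adj zero) (walk-along H (pos ∘ suc) (adj ∘ suc) e)

Consecutive : ∀ {m} → Fin m → Fin m → Set
Consecutive e e′ = toℕ e′ ≡ suc (toℕ e) ⊎ toℕ e ≡ suc (toℕ e′)

consecutive-sym : ∀ {m} {e e′ : Fin m} → Consecutive e e′ → Consecutive e′ e
consecutive-sym (inj₁ up) = inj₂ up
consecutive-sym (inj₂ down) = inj₁ down

consecutive-irrefl : ∀ {m} {e : Fin m} → ¬ Consecutive e e
consecutive-irrefl (inj₁ up) = 1+n≢n (≡.sym up)
consecutive-irrefl (inj₂ down) = 1+n≢n (≡.sym down)

consecutive-inject₁ : ∀ {m} (e : Fin m) → Consecutive (inject₁ e) (suc e)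
consecutive-inject₁ e = inj₁ (cong suc (≡.sym (toℕ-inject₁ e)))

consecutive-+ : ∀ c {m} {e e′ : Fin m} → Consecutive e e′ → c + toℕ e′ ≤ suc (c + toℕ e)
consecutive-+ c (inj₁ up) = ≤-reflexive (≡.trans (cong (c +_) up) (+-suc c _))
consecutive-+ c (inj₂ down) = ≤-trans (+-monoʳ-≤ c (≤-trans (n≤1+n _) (≤-reflexive (≡.sym down)))) (n≤1+n _)

m∸n≤1+m∸[1+n] : ∀ m n → m ∸ n ≤ suc (m ∸ suc n)
m∸n≤1+m∸[1+n] zero zero = z≤n
m∸n≤1+m∸[1+n] zero (suc n) = z≤n
m∸n≤1+m∸[1+n] (suc m) zero = ≤-refl
m∸n≤1+m∸[1+n] (suc m) (suc n) = m∸n≤1+m∸[1+n] m n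

consecutive-∸ : ∀ c {m} {e e′ : Fin m} → Consecutive e e′ → c ∸ toℕ e′ ≤ suc (c ∸ toℕ e)
consecutive-∸ c {e = e} (inj₁ up) = ≤-trans (∸-monoʳ-≤ c (≤-trans (n≤1+n (toℕ e)) (≤-reflexive (≡.sym up)))) (n≤1+n _)
consecutive-∸ c {e′ = e′} (inj₂ down) = subst (λ d → c ∸ toℕ e′ ≤ suc (c ∸ d)) (≡.sym down) (m∸n≤1+m∸[1+n] c (toℕ e′))

data Side : Set where
  rows columns : Side

_≟ˢ_ : DecidableEquality Side
rows ≟ˢ rows = yes refl
rows ≟ˢ columns = no λ ()
columns ≟ˢ rows = no λ ()
columns ≟ˢ columns = yes refl

Fin2↔Side : Fin 2 ↔ Side
Fin2↔Side = mk↔ₛ′ (λ { zero → rows ; (suc zero) → columns }) (λ { rows → zero ; columns → suc zero })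
                  (λ { rows → refl ; columns → refl }) (λ { zero → refl ; (suc zero) → refl })

module Counterexample (n₀ m₀ : ℕ) where

  N M : ℕ
  N = suc n₀
  M = suc m₀

  coord : Side → Fin N → Fin N → Fin N
  coord rows i j = i
  coord columns i j = j

  tip : Fin M
  tip = fromℕ m₀

  Along : Side → Fin N → Fin M → Side → Fin N → Fin M → Set
  Along s k e s′ k′ e′ = s ≡ s′ × k ≡ k′ × Consecutive e e′

  along-sym : ∀ {s k e s′ k′ e′} → Along s k e s′ k′ e′ → Along s′ k′ e′ s k e
  along-sym (refl , refl , c) = refl , refl , consecutive-sym c

  -- leg s k zero is attached to the cells of row k (s = rows) or column k (s = columns); leg s k tip is the
  -- far end of that path.
  data V : Set where
    cell : Fin N → Fin N → V
    leg : Side → Fin N → Fin M → V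

  R : V → V → Set
  R (cell i j) (cell i′ j′) = ¬ (i ≡ i′ × j ≡ j′)
  R (cell i j) (leg s k e) = coord s i j ≡ k × e ≡ zero
  R (leg s k e) (cell i j) = coord s i j ≡ k × e ≡ zero
  R (leg s k e) (leg s′ k′ e′) = Along s k e s′ k′ e′

  R-sym : ∀ {a b} → R a b → R b a
  R-sym {cell i j} {cell i′ j′} ≢ = λ { (refl , refl) → ≢ (refl , refl) }
  R-sym {cell _ _} {leg _ _ _} r = r
  R-sym {leg _ _ _} {cell _ _} r = r
  R-sym {leg _ _ _} {leg _ _ _} r = along-sym r

  R-irrefl : ∀ {a} → ¬ R a a
  R-irrefl {cell i j} ≢ = ≢ (refl , refl)
  R-irrefl {leg s k e} (_ , _ , c) = consecutive-irrefl c

  legs↔ : Fin (2 * (N * M)) ↔ (Side × (Fin N × Fin M))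
  legs↔ = ↔-trans *↔× (Fin2↔Side ×-↔ *↔×)

  n : ℕ
  n = N * N + 2 * (N * M)

  V-code : Fin n ↔ V
  V-code = ↔-trans +↔⊎ (↔-trans (*↔× ⊎-↔ legs↔) (mk↔ₛ′ to from (λ { (cell _ _) → refl ; (leg _ _ _) → refl })
                                                             (λ { (inj₁ _) → refl ; (inj₂ _) → refl })))
    where
    to : (Fin N × Fin N) ⊎ (Side × (Fin N × Fin M)) → V
    to (inj₁ (i , j)) = cell i j
    to (inj₂ (s , k , e)) = leg s k e
    from : V → (Fin N × Fin N) ⊎ (Side × (Fin N × Fin M))
    from (cell i j) = inj₁ (i , j)
    from (leg s k e) = inj₂ (s , k , e)

  open OnFiniteType V-code

  G : Graph n
  G = graph R R-sym R-irrefl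

  G-edge : ∀ a b → R a b → Adj G (encode a) (encode b)
  G-edge = edge R R-sym R-irrefl

  data W : Set where
    hub : W
    arm : Side → Fin N → Fin M → W

  TR : W → W → Set
  TR hub hub = ⊥
  TR hub (arm s k e) = e ≡ zero
  TR (arm s k e) hub = e ≡ zero
  TR (arm s k e) (arm s′ k′ e′) = Along s k e s′ k′ e′

  TR-sym : ∀ {a b} → TR a b → TR b a
  TR-sym {hub} {arm _ _ _} r = r
  TR-sym {arm _ _ _} {hub} r = r
  TR-sym {arm _ _ _} {arm _ _ _} r = along-sym r

  TR-irrefl : ∀ {a} → ¬ TR a a
  TR-irrefl {hub} ()
  TR-irrefl {arm s k e} (_ , _ , c) = consecutive-irrefl c

  p : ℕ
  p = 1 + 2 * (N * M)

  W-code : Fin p ↔ W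
  W-code = ↔-trans +↔⊎ (↔-trans (1↔⊤ ⊎-↔ legs↔) (mk↔ₛ′ to from (λ { hub → refl ; (arm _ _ _) → refl })
                                                             (λ { (inj₁ tt) → refl ; (inj₂ _) → refl })))
    where
    to : ⊤ ⊎ (Side × (Fin N × Fin M)) → W
    to (inj₁ tt) = hub
    to (inj₂ (s , k , e)) = arm s k e
    from : W → ⊤ ⊎ (Side × (Fin N × Fin M))
    from hub = inj₁ tt
    from (arm s k e) = inj₂ (s , k , e)

  open OnFiniteType W-code using () renaming (encode to node; decode to node⁻¹; encode-decode to node-node⁻¹;
    decode-encode to node⁻¹-node; decode-injective to node⁻¹-injective; graph to graphᵂ; edge to edgeᵂ)

  spider : Graph p
  spider = graphᵂ TR TR-sym TR-irrefl

  spider-edge : ∀ a b → TR a b → Adj spider (node a) (node b)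
  spider-edge = edgeᵂ TR TR-sym TR-irrefl

  depth : W → ℕ
  depth hub = 0
  depth (arm _ _ e) = suc (toℕ e)

  depth-≢ : ∀ {a b} → TR a b → depth a ≢ depth b
  depth-≢ {hub} {arm _ _ _} _ ()
  depth-≢ {arm _ _ _} {hub} _ ()
  depth-≢ {arm _ _ _} {arm _ _ _} (_ , _ , inj₁ up) eq = 1+n≢n (≡.trans (≡.sym up) (≡.sym (suc-injective eq)))
  depth-≢ {arm _ _ _} {arm _ _ _} (_ , _ , inj₂ down) eq = 1+n≢n (≡.trans (≡.sym down) (suc-injective eq))

  one-parent : ∀ {a b c} → TR a b → TR a c → depth b < depth a → depth c < depth a → b ≡ c
  one-parent {hub} {arm _ _ _} _ _ ()
  one-parent {arm _ _ _} {hub} {hub} _ _ _ _ = refl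
  one-parent {arm _ _ _} {hub} {arm _ _ _} refl _ _ (s≤s ())
  one-parent {arm _ _ _} {arm _ _ _} {hub} _ refl (s≤s ()) _
  one-parent {arm _ _ _} {arm _ _ _} {arm _ _ _} (refl , refl , c₁) (refl , refl , c₂) (s≤s lt₁) (s≤s lt₂) =
    cong (arm _ _) (toℕ-injective (suc-injective (≡.trans (≡.sym (downwards c₁ lt₁)) (downwards c₂ lt₂))))
    where
    downwards : ∀ {e e′ : Fin M} → Consecutive e e′ → toℕ e′ < toℕ e → toℕ e ≡ suc (toℕ e′)
    downwards (inj₂ down) _ = down
    downwards {e} (inj₁ up) lt = ⊥-elim (1+n≰n (≤-trans (n≤1+n _) (subst (λ x → suc x ≤ toℕ e) up lt)))

  spider-is-tree : IsTree spider
  spider-is-tree = s≤s z≤n , connected , acyclic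
    where
    open Walks spider
    acyclic : Acyclic spider
    acyclic = Cycles.one-lower-neighbour⇒acyclic spider (depth ∘ node⁻¹) depth-≢
                (λ a b lt lt′ → node⁻¹-injective (one-parent a b lt lt′))
    to-hub : ∀ w → ∃ λ l → Walk spider (node w) (node hub) l
    to-hub hub = 0 , stop tt
    to-hub (arm s k e) =
      _ , append (reverse (walk-along spider (node ∘ arm s k) along e)) (step tt (spider-edge (arm s k zero) hub refl) (stop tt))
      where
      along : ∀ e → Adj spider (node (arm s k (inject₁ e))) (node (arm s k (suc e)))
      along e = spider-edge (arm s k (inject₁ e)) (arm s k (suc e)) (refl , refl , consecutive-inject₁ e)
    connected : Connected spider
    connected u v with to-hub (node⁻¹ u) | to-hub (node⁻¹ v)
    ... | l₁ , w₁ | l₂ , w₂ =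
      l₁ + l₂ , subst₂ (λ a b → Walk spider a b (l₁ + l₂)) (node-node⁻¹ u) (node-node⁻¹ v) (append w₁ (reverse w₂))

  -- Every bag is a clique: the hub holds all cells, arm s k e holds leg s k e and the leg vertex below it,
  -- which for e = 0 means the cells of row/column k.
  InBag : W → V → Set
  InBag hub (cell i j) = ⊤
  InBag hub (leg _ _ _) = ⊥
  InBag (arm s k e) (cell i j) = coord s i j ≡ k × e ≡ zero
  InBag (arm s k e) (leg s′ k′ e′) = s′ ≡ s × k′ ≡ k × (e′ ≡ e ⊎ suc (toℕ e′) ≡ toℕ e)

  InBag? : ∀ t v → Dec (InBag t v)
  InBag? hub (cell i j) = yes tt
  InBag? hub (leg _ _ _) = no λ ()
  InBag? (arm s k e) (cell i j) = (coord s i j ≟ᶠ k) ×-dec (e ≟ᶠ zero)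
  InBag? (arm s k e) (leg s′ k′ e′) = (s′ ≟ˢ s) ×-dec (k′ ≟ᶠ k) ×-dec ((e′ ≟ᶠ e) ⊎-dec (suc (toℕ e′) ≟ℕ toℕ e))

  home : V → W
  home (cell i j) = hub
  home (leg s k e) = arm s k e

  in-home : ∀ v → InBag (home v) v
  in-home (cell i j) = tt
  in-home (leg s k e) = refl , refl , inj₁ refl

  next-to-home : ∀ {t v} → InBag t v → t ≡ home v ⊎ TR t (home v)
  next-to-home {hub} {cell i j} _ = inj₁ refl
  next-to-home {arm s k e} {cell i j} (_ , e≡0) = inj₂ e≡0
  next-to-home {arm s k e} {leg s′ k′ e′} (refl , refl , inj₁ refl) = inj₁ refl
  next-to-home {arm s k e} {leg s′ k′ e′} (refl , refl , inj₂ below) = inj₂ (refl , refl , inj₂ (≡.sym below))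

  edge-in-bag : ∀ a b → R a b → ∃ λ t → InBag t a × InBag t b
  edge-in-bag (cell i j) (cell i′ j′) _ = hub , tt , tt
  edge-in-bag (cell i j) (leg s k e) (refl , refl) = arm s k zero , (refl , refl) , (refl , refl , inj₁ refl)
  edge-in-bag (leg s k e) (cell i j) (refl , refl) = arm s k zero , (refl , refl , inj₁ refl) , (refl , refl)
  edge-in-bag (leg s k e) (leg s′ k′ e′) (refl , refl , inj₁ up) =
    arm s k e′ , (refl , refl , inj₂ (≡.sym up)) , (refl , refl , inj₁ refl)
  edge-in-bag (leg s k e) (leg s′ k′ e′) (refl , refl , inj₂ down) =
    arm s k e , (refl , refl , inj₁ refl) , (refl , refl , inj₂ (≡.sym down))

  bag-clique : ∀ t a b → InBag t a → InBag t b → a ≢ b → R a b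
  bag-clique t (cell i j) (cell i′ j′) _ _ a≢b (refl , refl) = a≢b refl
  bag-clique (arm s k e) (cell i j) (leg s′ k′ e′) (refl , refl) (refl , refl , inj₁ refl) _ = refl , refl
  bag-clique (arm s k e) (leg s′ k′ e′) (cell i j) (refl , refl , inj₁ refl) (refl , refl) _ = refl , refl
  bag-clique (arm s k e) (leg s′ k′ e₁) (leg s″ k″ e₂) (refl , refl , in₁) (refl , refl , in₂) a≢b with in₁ | in₂
  ... | inj₁ refl | inj₁ refl = ⊥-elim (a≢b refl)
  ... | inj₁ refl | inj₂ below = refl , refl , inj₂ (≡.sym below)
  ... | inj₂ below | inj₁ refl = refl , refl , inj₁ (≡.sym below)
  ... | inj₂ below₁ | inj₂ below₂ =
    ⊥-elim (a≢b (cong (leg s k) (toℕ-injective (suc-injective (≡.trans below₁ (≡.sym below₂))))))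

  spider-bag : Fin p → Subset n
  spider-bag t = subset (λ x → InBag? (node⁻¹ t) (decode x))

  ∈-bag⁺ : ∀ t {x} → InBag (node⁻¹ t) (decode x) → x ∈ₛ spider-bag t
  ∈-bag⁺ t = ∈-subset⁺ (λ x → InBag? (node⁻¹ t) (decode x))

  ∈-bag⁻ : ∀ t {x} → x ∈ₛ spider-bag t → InBag (node⁻¹ t) (decode x)
  ∈-bag⁻ t = ∈-subset⁻ (λ x → InBag? (node⁻¹ t) (decode x))

  in-node : ∀ {w v} → InBag w v → InBag (node⁻¹ (node w)) v
  in-node {w} {v} = subst (λ u → InBag u v) (≡.sym (node⁻¹-node w))

  decomposition : TreeDecomposition G
  decomposition = record
    { m = p
    ; T = spider
    ; tree = spider-is-tree
    ; bag = spider-bag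
    ; cover = λ x → node (home (decode x)) , ∈-bag⁺ (node (home (decode x))) (in-node (in-home (decode x)))
    ; edges = λ x y a → let (t , x∈t , y∈t) = edge-in-bag (decode x) (decode y) a in
        node t , ∈-bag⁺ (node t) (in-node x∈t) , ∈-bag⁺ (node t) (in-node y∈t)
    ; coherent = coherent
    }
    where
    open Walks spider
    Holds : V → Fin p → Set
    Holds v t = InBag (node⁻¹ t) v
    to-home : ∀ v t → Holds v t → ∃ λ l → WalkIn spider (Holds v) t (node (home v)) l
    to-home v t in-t with next-to-home in-t
    ... | inj₁ t≡home =
      0 , subst (λ u → WalkIn spider (Holds v) t u 0) (≡.trans (≡.sym (node-node⁻¹ t)) (cong node t≡home)) (stop in-t)
    ... | inj₂ adjacent =
      1 , step in-t (subst (TR (node⁻¹ t)) (≡.sym (node⁻¹-node _)) adjacent) (stop (in-node (in-home v)))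
    coherent : ∀ x t₁ t₂ → x ∈ₛ spider-bag t₁ → x ∈ₛ spider-bag t₂ →
               ∃ λ l → WalkIn spider (λ t → x ∈ₛ spider-bag t) t₁ t₂ l
    coherent x t₁ t₂ x∈t₁ x∈t₂ with to-home (decode x) t₁ (∈-bag⁻ t₁ x∈t₁) | to-home (decode x) t₂ (∈-bag⁻ t₂ x∈t₂)
    ... | _ , w₁ | _ , w₂ = _ , weaken (λ {t} → ∈-bag⁺ t) (append w₁ (reverse w₂))

  decomposition-width : TDIndepAtMost decomposition 1
  decomposition-width t S S⊆bag independent = all-equal⇒∣p∣≤1 S all-equal
    where
    all-equal : ∀ {x y} → x ∈ₛ S → y ∈ₛ S → x ≡ y
    all-equal {x} {y} x∈S y∈S with x ≟ᶠ y
    ... | yes x≡y = x≡y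
    ... | no x≢y = ⊥-elim (independent x y x∈S y∈S
          (bag-clique (node⁻¹ t) (decode x) (decode y) (∈-bag⁻ t (S⊆bag x∈S)) (∈-bag⁻ t (S⊆bag y∈S))
                      (x≢y ∘ decode-injective)))

  treeα-G : IsTreeα G 1
  treeα-G = (decomposition , decomposition-width) , λ _ → TreeαAtMost⇒≥1 G (encode (cell zero zero))

  module Distance (s : Side) (k₀ : Fin N) where

    -- A lower bound for the distance from leg s k₀ tip that changes by at most one along each edge.
    φ : V → ℕ
    φ (cell i j) with coord s i j ≟ᶠ k₀
    ... | yes _ = M
    ... | no _ = suc M
    φ (leg s′ k e) with s′ ≟ˢ s | k ≟ᶠ k₀
    ... | yes _ | yes _ = m₀ ∸ toℕ e
    ... | yes _ | no _ = suc (suc M) + toℕ e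
    ... | no _ | _ = suc M + toℕ e

    M≤φ-cell : ∀ i j → M ≤ φ (cell i j)
    M≤φ-cell i j with coord s i j ≟ᶠ k₀
    ... | yes _ = ≤-refl
    ... | no _ = n≤1+n M

    φ-cell≤1+M : ∀ i j → φ (cell i j) ≤ suc M
    φ-cell≤1+M i j with coord s i j ≟ᶠ k₀
    ... | yes _ = n≤1+n M
    ... | no _ = ≤-refl

    φ-cell-off : ∀ {i j} → coord s i j ≢ k₀ → φ (cell i j) ≡ suc M
    φ-cell-off {i} {j} off with coord s i j ≟ᶠ k₀
    ... | yes on = ⊥-elim (off on)
    ... | no _ = refl

    φ-cell-on : ∀ {i j} → coord s i j ≡ k₀ → φ (cell i j) ≡ M
    φ-cell-on {i} {j} on with coord s i j ≟ᶠ k₀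
    ... | yes _ = refl
    ... | no off = ⊥-elim (off on)

    φ-step : ∀ a b → R a b → φ b ≤ suc (φ a)
    φ-step (cell i j) (cell i′ j′) _ = ≤-trans (φ-cell≤1+M i′ j′) (s≤s (M≤φ-cell i j))
    φ-step (cell i j) (leg s′ k e) (on-k , refl) with s′ ≟ˢ s | k ≟ᶠ k₀
    ... | yes refl | yes refl = ≤-trans (n≤1+n m₀) (≤-trans (M≤φ-cell i j) (n≤1+n _))
    ... | yes refl | no k≢k₀ =
      s≤s (≤-reflexive (≡.trans (+-identityʳ _) (≡.sym (φ-cell-off (k≢k₀ ∘ ≡.trans (≡.sym on-k))))))
    ... | no _ | _ = s≤s (≤-trans (≤-reflexive (+-identityʳ M)) (M≤φ-cell i j))
    φ-step (leg s′ k e) (cell i j) (on-k , refl) with s′ ≟ˢ s | k ≟ᶠ k₀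
    ... | yes refl | yes refl = ≤-reflexive (φ-cell-on on-k)
    ... | yes refl | no _ = ≤-trans (φ-cell≤1+M i j) (s≤s (≤-trans (n≤1+n M) (≤-trans (n≤1+n _) (m≤m+n _ 0))))
    ... | no _ | _ = ≤-trans (φ-cell≤1+M i j) (s≤s (≤-trans (n≤1+n M) (m≤m+n _ 0)))
    φ-step (leg s′ k e) (leg s′ k e′) (refl , refl , c) with s′ ≟ˢ s | k ≟ᶠ k₀
    ... | yes _ | yes _ = consecutive-∸ m₀ c
    ... | yes _ | no _ = consecutive-+ (suc (suc M)) c
    ... | no _ | _ = consecutive-+ (suc M) c

    φ-own-tip : φ (leg s k₀ tip) ≡ 0
    φ-own-tip with s ≟ˢ s | k₀ ≟ᶠ k₀
    ... | yes _ | yes _ = ≡.trans (cong (m₀ ∸_) (toℕ-fromℕ m₀)) (n∸n≡0 m₀)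
    ... | yes _ | no k₀≢k₀ = ⊥-elim (k₀≢k₀ refl)
    ... | no s≢s | _ = ⊥-elim (s≢s refl)

    φ-other-tip : ∀ {k} → k ≢ k₀ → φ (leg s k tip) ≡ suc (M + M)
    φ-other-tip {k} k≢k₀ with s ≟ˢ s | k ≟ᶠ k₀
    ... | yes _ | no _ = ≡.trans (cong (suc (suc M) +_) (toℕ-fromℕ m₀)) (cong suc (≡.sym (+-suc M m₀)))
    ... | yes _ | yes k≡k₀ = ⊥-elim (k≢k₀ k≡k₀)
    ... | no s≢s | _ = ⊥-elim (s≢s refl)

  leg-walk : ∀ s k e → Walk G (encode (leg s k zero)) (encode (leg s k e)) (toℕ e)
  leg-walk s k = walk-along G (encode ∘ leg s k)
    (λ e → G-edge (leg s k (inject₁ e)) (leg s k (suc e)) (refl , refl , consecutive-inject₁ e))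

  tip-to-tip : ∀ i j → Walk G (encode (leg rows i tip)) (encode (leg columns j tip)) (M + M)
  tip-to-tip i j = subst (Walk G _ _) length≡
    (append down (step {v = encode (cell i j)} tt row-to-cell
                   (step {v = encode (leg columns j zero)} tt cell-to-column up)))
    where
    open Walks G
    down : Walk G (encode (leg rows i tip)) (encode (leg rows i zero)) (toℕ tip)
    down = reverse (leg-walk rows i tip)
    row-to-cell : Adj G (encode (leg rows i zero)) (encode (cell i j))
    row-to-cell = G-edge (leg rows i zero) (cell i j) (refl , refl)
    cell-to-column : Adj G (encode (cell i j)) (encode (leg columns j zero))
    cell-to-column = G-edge (cell i j) (leg columns j zero) (refl , refl)
    up : Walk G (encode (leg columns j zero)) (encode (leg columns j tip)) (toℕ tip)
    up = leg-walk columns j tip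
    length≡ : toℕ tip + suc (suc (toℕ tip)) ≡ M + M
    length≡ = ≡.trans (cong (λ d → d + suc (suc d)) (toℕ-fromℕ m₀)) (+-suc m₀ (suc m₀))

  IsTip : Side → V → Set
  IsTip s (cell _ _) = ⊥
  IsTip s (leg s′ k e) = s′ ≡ s × e ≡ tip

  IsTip? : ∀ s v → Dec (IsTip s v)
  IsTip? s (cell _ _) = no λ ()
  IsTip? s (leg s′ k e) = (s′ ≟ˢ s) ×-dec (e ≟ᶠ tip)

  tips : Side → Subset n
  tips s = subset (λ x → IsTip? s (decode x))

  tip-at : ∀ {s x} → x ∈ₛ tips s → ∃ λ k → x ≡ encode (leg s k tip)
  tip-at {s} {x} x∈ with decode x in decode-x | ∈-subset⁻ (λ x → IsTip? s (decode x)) x∈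
  ... | leg s k e | refl , refl = k , ≡.trans (≡.sym (encode-decode x)) (cong encode decode-x)

  N≤∣tips∣ : ∀ s → N ≤ ∣ tips s ∣
  N≤∣tips∣ s = injective⇒≤∣p∣ N (λ k → encode (leg s k tip)) (λ e → leg-injective (encode-injective e)) (tips s)
    (λ k → ∈-subset⁺ (λ x → IsTip? s (decode x)) (subst (IsTip s) (≡.sym (decode-encode (leg s k tip))) (refl , refl)))
    where
    leg-injective : ∀ {k k′} → leg s k tip ≡ leg s k′ tip → k ≡ k′
    leg-injective refl = refl

  tips-complete : ∀ a b → a ∈ₛ tips rows → b ∈ₛ tips columns → Adj (power G (M + M)) a b
  tips-complete a b a∈ b∈ with tip-at a∈ | tip-at b∈
  ... | i , refl | j , refl = (λ e → rows≢columns (encode-injective e)) , M + M , ≤-refl , tip-to-tip i j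
    where
    rows≢columns : leg rows i tip ≢ leg columns j tip
    rows≢columns ()

  tips-independent : ∀ s → Independent (power G (M + M)) (tips s)
  tips-independent s a b a∈ b∈ (a≢b , l , l≤ , w) with tip-at a∈ | tip-at b∈
  ... | k , refl | k′ , refl with k′ ≟ᶠ k
  ... | yes refl = a≢b refl
  ... | no k′≢k = 1+n≰n (≤-trans bound l≤)
    where
    open Distance s k
    bound : suc (M + M) ≤ l
    bound = subst₂ (λ x y → x ≤ y + l)
              (≡.trans (cong φ (decode-encode (leg s k′ tip))) (φ-other-tip k′≢k))
              (≡.trans (cong φ (decode-encode (leg s k tip))) φ-own-tip)
              (potential-bound G (φ ∘ decode) (λ {x} {y} → φ-step (decode x) (decode y)) w)

  no-narrow-decomposition : ¬ TreeαAtMost (power G (M + M)) n₀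
  no-narrow-decomposition (D , narrow) =
    let (t , tips⊆t) = complete-pair-in-bag D (tips rows) (tips columns) tips-complete
    in [ too-many t rows , too-many t columns ]′ tips⊆t
    where
    open TreeDecomposition D using (bag)
    too-many : ∀ t s → tips s ⊆ₛ bag t → ⊥
    too-many t s s⊆t = 1+n≰n (≤-trans (N≤∣tips∣ s) (narrow t (tips s) s⊆t (tips-independent s)))

proposition3p7 : (k : ℕ) → 0 < k → 2 ∣ k →
    ¬ Σ (ℕ → ℕ) (λ f → ∀ (n : ℕ) (G : Graph n) (a : ℕ) →
        IsTreeα G a → TreeαAtMost (power G k) (f a))
proposition3p7 _ () (divides zero refl)
proposition3p7 _ _ (divides (suc m₀) refl) (f , bounded) =
  no-narrow-decomposition (subst (λ k → TreeαAtMost (power G k) (f 1)) M*2≡M+M (bounded n G 1 treeα-G))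
  where
  open Counterexample (f 1) m₀
  M*2≡M+M : M * 2 ≡ M + M
  M*2≡M+M = ≡.trans (*-comm M 2) (cong (M +_) (+-identityʳ M))
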